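{- Let $Q$ be a finite (left) quasifield with $q$ elements, $d\geq 1$ an integer and $\gamma\in Q$. The product graph $\mathcal{DP}_Q(d,\gamma)$ is $q^d$-regular.
   Context: A (left) quasifield is a set $Q$ with two binary operations $+$ and $\cdot$ such that $(Q,+)$ is a group with identity $0$; $(Q\setminus\{0\},\cdot)$ is a loop (for all $a,b$ the equations $a\cdot x=b$ and $y\cdot a=b$ have unique solutions, and there is an identity $1$); $a\cdot(b+c)=a\cdot b+a\cdot c$ for all $a,b,c$; $0\cdot x=0$ for all $x$; and for $a\neq b$ the equation $a\cdot x=b\cdot x+c$ has exactly one solution $x$. The product graph $\mathcal{DP}_Q(d,\gamma)$ is the bipartite graph with parts $X$ and $Y$, each a disjoint copy of $Q^{d+1}$, in which $(x_1,\dots,x_{d+1})_X\in X$ is adjacent to $(y_1,\dots,y_{d+1})_Y\in Y$ if and only if $x_{d+1}+\gamma = x_1\cdot y_1 + x_2\cdot y_2 + \cdots + x_d\cdot y_d + y_{d+1}$. -}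

module Defs where

open import Level using (Level; suc; _⊔_)
open import Data.Nat using (ℕ; _^_) renaming (suc to sucℕ)
open import Data.Fin using (Fin)
open import Data.Product using (Σ; ∃; ∃-syntax; ∃!; _×_; _,_)
open import Data.Vec using (Vec; []; _∷_; init; last)
open import Relation.Binary.PropositionalEquality using (_≡_; _≢_)
open import Algebra.Structures using (IsGroup)
open import Function.Bundles using (_↔_)

record Quasifield (ℓ : Level) : Set (suc ℓ) where
  infixl 7 _·_
  infixl 6 _+_
  field
    Carrier : Set ℓ
    _+_     : Carrier → Carrier → Carrier
    _·_     : Carrier → Carrier → Carrier
    0#      : Carrier
    -_      : Carrier → Carrier
    1#      : Carrier
    +-isGroup : IsGroup _≡_ _+_ 0# -_
    -- (Q \ {0}, ·) is a loop with identity 1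
    1≢0       : 1# ≢ 0#
    ·-closed  : ∀ a b → a ≢ 0# → b ≢ 0# → a · b ≢ 0#
    ·-identityˡ : ∀ x → x ≢ 0# → 1# · x ≡ x
    ·-identityʳ : ∀ x → x ≢ 0# → x · 1# ≡ x
    left-div  : ∀ a b → a ≢ 0# → b ≢ 0# →
                ∃! _≡_ (λ x → (x ≢ 0#) × (a · x ≡ b))
    right-div : ∀ a b → a ≢ 0# → b ≢ 0# →
                ∃! _≡_ (λ y → (y ≢ 0#) × (y · a ≡ b))
    distribˡ  : ∀ a b c → a · (b + c) ≡ a · b + a · c
    zeroˡ     : ∀ x → 0# · x ≡ 0#
    unique-sol : ∀ a b c → a ≢ b → ∃! _≡_ (λ x → a · x ≡ b · x + c)

module ProductGraph {ℓ : Level} (Q : Quasifield ℓ) where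
  open Quasifield Q

  dotPlus : ∀ {n} → Vec Carrier n → Vec Carrier n → Carrier → Carrier
  dotPlus []       []       t = t
  dotPlus (x ∷ xs) (y ∷ ys) t = x · y + dotPlus xs ys t

  -- Vertices of each part X, Y of DP_Q(d,γ): elements of Q^{d+1}
  Point : ℕ → Set ℓ
  Point d = Vec Carrier (sucℕ d)

  Adj : (d : ℕ) (γ : Carrier) → Point d → Point d → Set ℓ
  Adj d γ x y = last x + γ ≡ dotPlus (init x) (init y) (last y)

  IsRegular : (d : ℕ) (γ : Carrier) (k : ℕ) → Set ℓ
  IsRegular d γ k =
    (∀ (x : Point d) → Fin k ↔ Σ (Point d) (λ y → Adj d γ x y)) ×
    (∀ (y : Point d) → Fin k ↔ Σ (Point d) (λ x → Adj d γ x y))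

{-# OPTIONS --safe #-}
-- Only the group (Q,+) and the finiteness of Q matter.  Fixing a vertex, its
-- adjacency relation is a single group equation in the last coordinate of the
-- other endpoint, uniquely solvable whatever the first d coordinates are; so
-- the neighbourhood is in bijection with Q^d, which has q^d elements.
module Submission where

open import Defs
open import Level using (Level)
open import Data.Nat using (ℕ; suc; _^_; _≥_)
open import Data.Fin using (Fin)
open import Function.Bundles using (_↔_)

open import Algebra.Bundles using (Group)
import Algebra.Properties.Group as GroupProperties
open import Axiom.UniquenessOfIdentityProofs using (UIP; module Decidable⇒UIP)
open import Data.Fin.Properties using (inj⇒≟)
open import Data.Product using (Σ; _,_; proj₁; proj₂)
open import Data.Product.Properties using (Σ-≡,≡→≡)
open import Data.Vec using (Vec; []; _∷_; init; last; _∷ʳ_; initLast)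
open import Data.Vec.Properties using (init-∷ʳ; last-∷ʳ)
open import Data.Vec.Recursive using (lift↔; Fin[m^n]↔Fin[m]^n)
open import Data.Vec.Recursive.Properties using (↔Vec)
open import Function.Bundles using (mk↔ₛ′)
open import Function.Properties.Inverse using (↔-trans; ↔-sym; ↔⇒↣)
open import Relation.Binary.PropositionalEquality
  using (_≡_; sym; trans; cong; subst₂; module ≡-Reasoning)
open import Relation.Nullary.Irrelevant using (Irrelevant)

Fin[m^n]↔Vec : ∀ {a} {A : Set a} (m n : ℕ) → Fin m ↔ A → Fin (m ^ n) ↔ Vec A n
Fin[m^n]↔Vec m n Fin[m]↔A =
  ↔-trans (Fin[m^n]↔Fin[m]^n m n) (↔-trans (lift↔ n Fin[m]↔A) (↔Vec n))

finite⇒UIP : ∀ {a} {A : Set a} (m : ℕ) → Fin m ↔ A → UIP A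
finite⇒UIP m Fin[m]↔A = Decidable⇒UIP.≡-irrelevant (inj⇒≟ (↔⇒↣ (↔-sym Fin[m]↔A)))

init∷ʳlast : ∀ {a} {A : Set a} {n} (v : Vec A (suc n)) → v ≡ init v ∷ʳ last v
init∷ʳlast v = proj₂ (proj₂ (initLast v))

module _ {a p} {A : Set a} {n : ℕ} (P : Vec A n → A → Set p)
         (P-irrelevant : ∀ {xs t} → Irrelevant (P xs t))
         (f : Vec A n → A)
         (P-f : ∀ xs → P xs (f xs))
         (P⇒≡f : ∀ xs {t} → P xs t → t ≡ f xs) where

  Vec↔Σ-determinedLast : Vec A n ↔ Σ (Vec A (suc n)) (λ v → P (init v) (last v))
  Vec↔Σ-determinedLast = mk↔ₛ′ extend (λ (v , _) → init v) extend∘init (λ xs → init-∷ʳ (f xs) xs)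
    where
    extend : Vec A n → Σ (Vec A (suc n)) (λ v → P (init v) (last v))
    extend xs = xs ∷ʳ f xs
              , subst₂ P (sym (init-∷ʳ (f xs) xs)) (sym (last-∷ʳ (f xs) xs)) (P-f xs)

    extend∘init : ∀ vp → extend (init (proj₁ vp)) ≡ vp
    extend∘init (v , pv) =
      Σ-≡,≡→≡ (sym (trans (init∷ʳlast v) (cong (init v ∷ʳ_) (P⇒≡f (init v) pv))) , P-irrelevant _ _)

module _ {ℓ : Level} (Q : Quasifield ℓ) where
  open Quasifield Q
  open ProductGraph Q

  +-group : Group ℓ ℓ
  +-group = record { isGroup = +-isGroup }

  open Group +-group using (assoc; identityˡ; _\\_; _//_)
  open GroupProperties +-group using (\\-leftDividesˡ; \\-leftDividesʳ; //-rightDividesˡ; //-rightDividesʳ)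

  dot : ∀ {n} → Vec Carrier n → Vec Carrier n → Carrier
  dot xs ys = dotPlus xs ys 0#

  dotPlus≡dot+ : ∀ {n} (xs ys : Vec Carrier n) t → dotPlus xs ys t ≡ dot xs ys + t
  dotPlus≡dot+ []       []       t = sym (identityˡ t)
  dotPlus≡dot+ (x ∷ xs) (y ∷ ys) t = begin
    x · y + dotPlus xs ys t    ≡⟨ cong (x · y +_) (dotPlus≡dot+ xs ys t) ⟩
    x · y + (dot xs ys + t)    ≡⟨ assoc (x · y) (dot xs ys) t ⟨
    x · y + dot xs ys + t      ∎
    where open ≡-Reasoning

  module _ (uip : UIP Carrier) (d : ℕ) (γ : Carrier) where

    Vec↔neighboursOfX : (x : Point d) → Vec Carrier d ↔ Σ (Point d) (λ y → Adj d γ x y)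
    Vec↔neighboursOfX x = Vec↔Σ-determinedLast P uip f P-f P⇒≡f
      where
      c : Carrier
      c = last x + γ
      P : Vec Carrier d → Carrier → Set ℓ
      P ys t = c ≡ dotPlus (init x) ys t
      f : Vec Carrier d → Carrier
      f ys = dot (init x) ys \\ c
      P-f : ∀ ys → P ys (f ys)
      P-f ys = sym (trans (dotPlus≡dot+ (init x) ys (f ys)) (\\-leftDividesˡ (dot (init x) ys) c))
      P⇒≡f : ∀ ys {t} → P ys t → t ≡ f ys
      P⇒≡f ys {t} e = begin
        t                          ≡⟨ \\-leftDividesʳ s t ⟨
        s \\ (s + t)               ≡⟨ cong (s \\_) (dotPlus≡dot+ (init x) ys t) ⟨
        s \\ dotPlus (init x) ys t ≡⟨ cong (s \\_) e ⟨
        f ys                       ∎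
        where
        s : Carrier
        s = dot (init x) ys
        open ≡-Reasoning

    Vec↔neighboursOfY : (y : Point d) → Vec Carrier d ↔ Σ (Point d) (λ x → Adj d γ x y)
    Vec↔neighboursOfY y = Vec↔Σ-determinedLast P uip f P-f P⇒≡f
      where
      P : Vec Carrier d → Carrier → Set ℓ
      P xs t = t + γ ≡ dotPlus xs (init y) (last y)
      f : Vec Carrier d → Carrier
      f xs = dotPlus xs (init y) (last y) // γ
      P-f : ∀ xs → P xs (f xs)
      P-f xs = //-rightDividesˡ γ (dotPlus xs (init y) (last y))
      P⇒≡f : ∀ xs {t} → P xs t → t ≡ f xs
      P⇒≡f xs {t} e = trans (sym (//-rightDividesʳ γ t)) (cong (_// γ) e)

lemma4p1 : ∀ {ℓ : Level} (Q : Quasifield ℓ) (q : ℕ) →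
    (Fin q ↔ Quasifield.Carrier Q) →
    (d : ℕ) → d ≥ 1 → (γ : Quasifield.Carrier Q) →
    ProductGraph.IsRegular Q d γ (q ^ d)
lemma4p1 Q q Fin[q]↔Q d _ γ =
    (λ x → ↔-trans Fin[q^d]↔Q^d (Vec↔neighboursOfX Q uip d γ x))
  , (λ y → ↔-trans Fin[q^d]↔Q^d (Vec↔neighboursOfY Q uip d γ y))
  where
  Fin[q^d]↔Q^d : Fin (q ^ d) ↔ Vec (Quasifield.Carrier Q) d
  Fin[q^d]↔Q^d = Fin[m^n]↔Vec q d Fin[q]↔Q
  uip : UIP (Quasifield.Carrier Q)
  uip = finite⇒UIP q Fin[q]↔Q
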